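{- Let $n,d\in\mathbb{N}$, $\mathbf{x}=(x_1,\dots,x_n)\in\mathbb{Z}^n$, $\tau\in\mathbb{Z}$, and let $\alpha,q$ be integers with $\alpha>d$ and $q>d\sum_{i=1}^n|x_i|+|\tau|$. Let $\mathcal{L}_{\alpha,q}\subseteq\mathbb{Z}^{n+1}$ be the lattice generated by the rows $(\alpha q,0,\dots,0)$ and, for $i=1,\dots,n$, the vectors $(\alpha x_i,\mathbf{e}_i)$ (i.e. first coordinate $\alpha x_i$, coordinate $i+1$ equal to $1$, all others $0$). Let $\mathbf{t}=(\alpha\tau,0,\dots,0)\in\mathbb{Z}^{n+1}$. Then \[ \mathcal{L}_{\alpha,q}\cap\bigl(\mathbf{t}+d\,\mathbf{B}_\infty^{n+1}\bigr)=\Bigl\{(\alpha\tau,c_1,\dots,c_n)\in\mathbb{Z}^{n+1}\ \Bigm|\ \sum_{i=1}^nc_ix_i=\tau,\ |c_i|\le d\ \text{for all } i\Bigr\}. \]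
   Context: $\mathbf{B}_\infty^{m}=\{\mathbf{y}\in\mathbb{R}^m:\|\mathbf{y}\|_\infty\le1\}$. -}

module Defs where

open import Data.Nat using (ℕ; zero; suc)
open import Data.Integer using (ℤ; +_; _+_; _-_; _*_; ∣_∣; _≤_)
open import Data.Fin using (Fin; zero; suc; _≟_)
open import Data.Product using (Σ; _×_)
open import Relation.Nullary using (yes; no)
open import Relation.Binary.PropositionalEquality using (_≡_)

∑ : ∀ {n} → (Fin n → ℤ) → ℤ
∑ {zero}  f = + 0
∑ {suc n} f = f zero + ∑ (λ i → f (suc i))

gen₀ : ∀ {n} → ℤ → ℤ → Fin (suc n) → ℤ
gen₀ α q zero    = α * q
gen₀ α q (suc j) = + 0

genᵢ : ∀ {n} → ℤ → (Fin n → ℤ) → Fin n → Fin (suc n) → ℤ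
genᵢ α x i zero = α * x i
genᵢ α x i (suc j) with i ≟ j
... | yes _ = + 1
... | no  _ = + 0

InLattice : ∀ {n} → ℤ → ℤ → (Fin n → ℤ) → (Fin (suc n) → ℤ) → Set
InLattice {n} α q x v =
  Σ ℤ λ k₀ → Σ (Fin n → ℤ) λ k →
    ∀ j → v j ≡ k₀ * gen₀ α q j + ∑ (λ i → k i * genᵢ α x i j)

target : ∀ {n} → ℤ → ℤ → Fin (suc n) → ℤ
target α τ zero    = α * τ
target α τ (suc j) = + 0

InBox : ∀ {m} → (Fin m → ℤ) → ℕ → (Fin m → ℤ) → Set
InBox t d v = ∀ j → + ∣ v j - t j ∣ ≤ + d

-- Write a lattice vector as k₀ (αq, 0, …, 0) + ∑ kᵢ (αxᵢ, eᵢ). Its first coordinate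
-- α (k₀ q + ∑ kᵢ xᵢ) and the target coordinate α τ are multiples of α at distance at most
-- d < α, hence equal: k₀ q + ∑ kᵢ xᵢ = τ. The other coordinates are the kᵢ, so |kᵢ| ≤ d and
-- |k₀ q| = |τ - ∑ kᵢ xᵢ| ≤ |τ| + d ∑ |xᵢ| < q, which forces k₀ = 0.
module Submission where

open import Defs
open import Data.Nat using (ℕ; suc)
open import Data.Integer using (ℤ; +_; _+_; _*_; ∣_∣; _≤_; _<_)
open import Data.Fin using (Fin; zero; suc)
open import Data.Product using (_×_)
open import Function.Bundles using (_⇔_)
open import Relation.Binary.PropositionalEquality using (_≡_)

open import Data.Fin using (_≟_)
open import Data.Fin.Properties using (suc-injective)
open import Data.Integer using (_-_; +≤+; +<+)
open import Data.Integer.Properties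
  using ( +-identityˡ; +-identityʳ; *-identityʳ; *-zeroʳ; *-distribˡ-+
        ; ≤-reflexive; ≤-<-trans; +-mono-≤; +-monoʳ-≤; +-comm; *-monoʳ-≤-nonNeg
        ; abs-*; pos-*; ∣i∣≡0⇒i≡0; i-j≡0⇒i≡j; i≡j⇒i-j≡0; ∣i+j∣≤∣i∣+∣j∣; ∣i-j∣≤∣i∣+∣j∣
        ; module ≤-Reasoning )
open import Data.Integer.Tactic.RingSolver using (solve-∀)
import Data.Nat as ℕ
import Data.Nat.Properties as ℕP
open import Data.Product using (_,_; proj₁; proj₂)
open import Data.Empty using (⊥-elim)
open import Function.Base using (_∘_)
open import Function.Bundles using (mk⇔; Equivalence)
open import Relation.Nullary using (yes; no)
open import Relation.Binary.PropositionalEquality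
  using (refl; sym; trans; cong; cong₂; subst; subst₂; _≢_; module ≡-Reasoning)

∑-cong : ∀ {n} {f g : Fin n → ℤ} → (∀ i → f i ≡ g i) → ∑ f ≡ ∑ g
∑-cong {ℕ.zero} f≡g = refl
∑-cong {suc n}  f≡g = cong₂ _+_ (f≡g zero) (∑-cong (λ i → f≡g (suc i)))

∑-zero : ∀ {n} {f : Fin n → ℤ} → (∀ i → f i ≡ + 0) → ∑ f ≡ + 0
∑-zero {ℕ.zero} f≡0 = refl
∑-zero {suc n}  f≡0 = cong₂ _+_ (f≡0 zero) (∑-zero (λ i → f≡0 (suc i)))

∑-δ : ∀ {n} (f : Fin n → ℤ) (j : Fin n) → (∀ i → i ≢ j → f i ≡ + 0) → ∑ f ≡ f j
∑-δ f zero f≡0 = begin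
  f zero + ∑ (λ i → f (suc i))   ≡⟨ cong (_+_ (f zero)) (∑-zero (λ i → f≡0 (suc i) λ ())) ⟩
  f zero + + 0                   ≡⟨ +-identityʳ (f zero) ⟩
  f zero                         ∎
  where open ≡-Reasoning
∑-δ f (suc j) f≡0 = begin
  f zero + ∑ (λ i → f (suc i))
    ≡⟨ cong₂ _+_ (f≡0 zero λ ()) (∑-δ (λ i → f (suc i)) j λ i i≢j → f≡0 (suc i) (i≢j ∘ suc-injective)) ⟩
  + 0 + f (suc j)                ≡⟨ +-identityˡ (f (suc j)) ⟩
  f (suc j)                      ∎
  where open ≡-Reasoning

i*[j*k]+j*l≡j*[i*k+l] : ∀ i j k l → i * (j * k) + j * l ≡ j * (i * k + l)
i*[j*k]+j*l≡j*[i*k+l] = solve-∀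

∑-*ˡ : ∀ {n} (α : ℤ) (k x : Fin n → ℤ) → ∑ (λ i → k i * (α * x i)) ≡ α * ∑ (λ i → k i * x i)
∑-*ˡ {ℕ.zero} α k x = sym (*-zeroʳ α)
∑-*ˡ {suc n}  α k x = begin
  k zero * (α * x zero) + ∑ (λ i → k (suc i) * (α * x (suc i)))
    ≡⟨ cong (_+_ (k zero * (α * x zero))) (∑-*ˡ α (λ i → k (suc i)) (λ i → x (suc i))) ⟩
  k zero * (α * x zero) + α * ∑ (λ i → k (suc i) * x (suc i))
    ≡⟨ i*[j*k]+j*l≡j*[i*k+l] (k zero) α (x zero) _ ⟩
  α * (k zero * x zero + ∑ (λ i → k (suc i) * x (suc i))) ∎
  where open ≡-Reasoning

∣∑*∣≤*∑∣∣ : ∀ {n} (d : ℕ) (k x : Fin n → ℤ) → (∀ i → + ∣ k i ∣ ≤ + d) →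
            + ∣ ∑ (λ i → k i * x i) ∣ ≤ + d * ∑ (λ i → + ∣ x i ∣)
∣∑*∣≤*∑∣∣ {ℕ.zero} d k x _ = ≤-reflexive (sym (*-zeroʳ (+ d)))
∣∑*∣≤*∑∣∣ {suc n} d k x ∣k∣≤d = begin
  + ∣ k zero * x zero + ∑ (λ i → k (suc i) * x (suc i)) ∣
    ≤⟨ +≤+ (∣i+j∣≤∣i∣+∣j∣ (k zero * x zero) _) ⟩
  + ∣ k zero * x zero ∣ + + ∣ ∑ (λ i → k (suc i) * x (suc i)) ∣
    ≤⟨ +-mono-≤ head≤ (∣∑*∣≤*∑∣∣ d (λ i → k (suc i)) (λ i → x (suc i)) (λ i → ∣k∣≤d (suc i))) ⟩
  + d * + ∣ x zero ∣ + + d * ∑ (λ i → + ∣ x (suc i) ∣)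
    ≡⟨ sym (*-distribˡ-+ (+ d) (+ ∣ x zero ∣) _) ⟩
  + d * ∑ (λ i → + ∣ x i ∣) ∎
  where
  open ≤-Reasoning
  head≤ : + ∣ k zero * x zero ∣ ≤ + d * + ∣ x zero ∣
  head≤ = begin
    + ∣ k zero * x zero ∣           ≡⟨ cong +_ (abs-* (k zero) (x zero)) ⟩
    + (∣ k zero ∣ ℕ.* ∣ x zero ∣)   ≡⟨ pos-* ∣ k zero ∣ ∣ x zero ∣ ⟩
    + ∣ k zero ∣ * + ∣ x zero ∣     ≤⟨ *-monoʳ-≤-nonNeg (+ ∣ x zero ∣) (∣k∣≤d zero) ⟩
    + d * + ∣ x zero ∣              ∎

∣i*j∣<j⇒i≡0 : ∀ i j → + ∣ i * j ∣ < j → i ≡ + 0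
∣i*j∣<j⇒i≡0 i (+ m) (+<+ ∣ij∣<m) = ∣i∣≡0⇒i≡0 (ℕP.n<1⇒n≡0 (ℕP.*-cancelʳ-< m ∣ i ∣ 1 ∣i∣m<1m))
  where
  ∣i∣m<1m : ∣ i ∣ ℕ.* m ℕ.< 1 ℕ.* m
  ∣i∣m<1m = subst₂ ℕ._<_ (abs-* i (+ m)) (sym (ℕP.*-identityˡ m)) ∣ij∣<m

∣i*j-i*k∣<i⇒j≡k : ∀ i j k → + ∣ i * j - i * k ∣ < i → j ≡ k
∣i*j-i*k∣<i⇒j≡k i j k lt = i-j≡0⇒i≡j j k (∣i*j∣<j⇒i≡0 (j - k) i (subst (λ z → + ∣ z ∣ < i) (i*j-i*k≡[j-k]*i i j k) lt))
  where
  i*j-i*k≡[j-k]*i : ∀ i j k → i * j - i * k ≡ (j - k) * i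
  i*j-i*k≡[j-k]*i = solve-∀

genᵢ-diag : ∀ {n} α (x : Fin n → ℤ) i → genᵢ α x i (suc i) ≡ + 1
genᵢ-diag α x i with i ≟ i
... | yes _   = refl
... | no  i≢i = ⊥-elim (i≢i refl)

genᵢ-offdiag : ∀ {n} α (x : Fin n → ℤ) {i j} → i ≢ j → genᵢ α x i (suc j) ≡ + 0
genᵢ-offdiag α x {i} {j} i≢j with i ≟ j
... | yes i≡j = ⊥-elim (i≢j i≡j)
... | no  _   = refl

latticeVector : ∀ {n} → ℤ → ℤ → (Fin n → ℤ) → ℤ → (Fin n → ℤ) → Fin (suc n) → ℤ
latticeVector α q x k₀ k j = k₀ * gen₀ α q j + ∑ (λ i → k i * genᵢ α x i j)

latticeVector-head : ∀ {n} α q (x : Fin n → ℤ) k₀ k →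
                     latticeVector α q x k₀ k zero ≡ α * (k₀ * q + ∑ (λ i → k i * x i))
latticeVector-head α q x k₀ k = begin
  k₀ * (α * q) + ∑ (λ i → k i * (α * x i))   ≡⟨ cong (_+_ (k₀ * (α * q))) (∑-*ˡ α k x) ⟩
  k₀ * (α * q) + α * ∑ (λ i → k i * x i)     ≡⟨ i*[j*k]+j*l≡j*[i*k+l] k₀ α q _ ⟩
  α * (k₀ * q + ∑ (λ i → k i * x i))         ∎
  where open ≡-Reasoning

latticeVector-tail : ∀ {n} α q (x : Fin n → ℤ) k₀ k j → latticeVector α q x k₀ k (suc j) ≡ k j
latticeVector-tail α q x k₀ k j = begin
  k₀ * + 0 + ∑ (λ i → k i * genᵢ α x i (suc j))   ≡⟨ cong₂ _+_ (*-zeroʳ k₀) (∑-δ _ j offdiag) ⟩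
  + 0 + k j * genᵢ α x j (suc j)                  ≡⟨ +-identityˡ _ ⟩
  k j * genᵢ α x j (suc j)                        ≡⟨ cong (k j *_) (genᵢ-diag α x j) ⟩
  k j * + 1                                       ≡⟨ *-identityʳ (k j) ⟩
  k j                                             ∎
  where
  open ≡-Reasoning
  offdiag : ∀ i → i ≢ j → k i * genᵢ α x i (suc j) ≡ + 0
  offdiag i i≢j = trans (cong (k i *_) (genᵢ-offdiag α x i≢j)) (*-zeroʳ (k i))

InBox-target⇔ : ∀ {n} α τ d (v : Fin (suc n) → ℤ) →
                InBox (target α τ) d v ⇔ ((+ ∣ v zero - α * τ ∣ ≤ + d) × (∀ i → + ∣ v (suc i) ∣ ≤ + d))
InBox-target⇔ α τ d v = mk⇔ (λ box → box zero , λ i → tail≤ (box (suc i)))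
                            (λ { (head≤ , tail≤d) → λ { zero → head≤ ; (suc i) → from-tail≤ (tail≤d i) } })
  where
  tail≤ : ∀ {i} → + ∣ v (suc i) + + 0 ∣ ≤ + d → + ∣ v (suc i) ∣ ≤ + d
  tail≤ {i} = subst (λ z → + ∣ z ∣ ≤ + d) (+-identityʳ (v (suc i)))
  from-tail≤ : ∀ {i} → + ∣ v (suc i) ∣ ≤ + d → + ∣ v (suc i) + + 0 ∣ ≤ + d
  from-tail≤ {i} = subst (λ z → + ∣ z ∣ ≤ + d) (sym (+-identityʳ (v (suc i))))

Solution : ∀ {n} → ℕ → (Fin n → ℤ) → ℤ → ℤ → (Fin (suc n) → ℤ) → Set
Solution d x τ α v = (v zero ≡ α * τ) × (∑ (λ i → v (suc i) * x i) ≡ τ) × (∀ i → + ∣ v (suc i) ∣ ≤ + d)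

lattice∩box⇒solution : ∀ {n} d (x : Fin n → ℤ) τ α q → + d < α → + d * ∑ (λ i → + ∣ x i ∣) + + ∣ τ ∣ < q →
                       ∀ v → InLattice α q x v × InBox (target α τ) d v → Solution d x τ α v
lattice∩box⇒solution d x τ α q d<α bound<q v ((k₀ , k , v≡) , box) = v₀≡ατ , ∑≡τ , ∣tail∣≤d
  where
  S : ℤ
  S = ∑ (λ i → k i * x i)
  head≤ : + ∣ v zero - α * τ ∣ ≤ + d
  head≤ = proj₁ (Equivalence.to (InBox-target⇔ α τ d v) box)
  ∣tail∣≤d : ∀ i → + ∣ v (suc i) ∣ ≤ + d
  ∣tail∣≤d = proj₂ (Equivalence.to (InBox-target⇔ α τ d v) box)
  v₀≡ : v zero ≡ α * (k₀ * q + S)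
  v₀≡ = trans (v≡ zero) (latticeVector-head α q x k₀ k)
  residue≡τ : k₀ * q + S ≡ τ
  residue≡τ = ∣i*j-i*k∣<i⇒j≡k α _ τ (≤-<-trans (subst (λ z → + ∣ z - α * τ ∣ ≤ + d) v₀≡ head≤) d<α)
  k≡tail : ∀ i → k i ≡ v (suc i)
  k≡tail i = sym (trans (v≡ (suc i)) (latticeVector-tail α q x k₀ k i))
  ∣τ-S∣<q : + ∣ τ - S ∣ < q
  ∣τ-S∣<q = begin-strict
    + ∣ τ - S ∣                              ≤⟨ +≤+ (∣i-j∣≤∣i∣+∣j∣ τ S) ⟩
    + ∣ τ ∣ + + ∣ S ∣                        ≤⟨ +-monoʳ-≤ (+ ∣ τ ∣) (∣∑*∣≤*∑∣∣ d k x ∣k∣≤d) ⟩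
    + ∣ τ ∣ + + d * ∑ (λ i → + ∣ x i ∣)      ≡⟨ +-comm (+ ∣ τ ∣) (+ d * ∑ (λ i → + ∣ x i ∣)) ⟩
    + d * ∑ (λ i → + ∣ x i ∣) + + ∣ τ ∣      <⟨ bound<q ⟩
    q                                        ∎
    where
    open ≤-Reasoning
    ∣k∣≤d : ∀ i → + ∣ k i ∣ ≤ + d
    ∣k∣≤d i = subst (λ z → + ∣ z ∣ ≤ + d) (sym (k≡tail i)) (∣tail∣≤d i)
  k₀≡0 : k₀ ≡ + 0
  k₀≡0 = ∣i*j∣<j⇒i≡0 k₀ q (subst (λ z → + ∣ z ∣ < q) τ-S≡k₀q ∣τ-S∣<q)
    where
    i+j-j≡i : ∀ i j → i + j - j ≡ i
    i+j-j≡i = solve-∀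
    τ-S≡k₀q : τ - S ≡ k₀ * q
    τ-S≡k₀q = trans (cong (_- S) (sym residue≡τ)) (i+j-j≡i (k₀ * q) S)
  ∑≡τ : ∑ (λ i → v (suc i) * x i) ≡ τ
  ∑≡τ = begin
    ∑ (λ i → v (suc i) * x i)   ≡⟨ ∑-cong (λ i → cong (_* x i) (sym (k≡tail i))) ⟩
    S                           ≡⟨ sym (+-identityˡ S) ⟩
    + 0 * q + S                 ≡⟨ cong (λ k₀ → k₀ * q + S) (sym k₀≡0) ⟩
    k₀ * q + S                  ≡⟨ residue≡τ ⟩
    τ                           ∎
    where open ≡-Reasoning
  v₀≡ατ : v zero ≡ α * τ
  v₀≡ατ = trans v₀≡ (cong (α *_) residue≡τ)

solution⇒lattice∩box : ∀ {n} d (x : Fin n → ℤ) τ α q v →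
                       Solution d x τ α v → InLattice α q x v × InBox (target α τ) d v
solution⇒lattice∩box {n} d x τ α q v (v₀≡ατ , ∑≡τ , ∣tail∣≤d) = (+ 0 , tail , v≡) , box
  where
  tail : Fin n → ℤ
  tail i = v (suc i)
  v≡ : ∀ j → v j ≡ latticeVector α q x (+ 0) tail j
  v≡ zero = begin
    v zero                                   ≡⟨ v₀≡ατ ⟩
    α * τ                                    ≡⟨ cong (α *_) (trans (sym ∑≡τ) (sym (+-identityˡ _))) ⟩
    α * (+ 0 * q + ∑ (λ i → tail i * x i))   ≡⟨ latticeVector-head α q x (+ 0) tail ⟨
    latticeVector α q x (+ 0) tail zero      ∎
    where open ≡-Reasoning
  v≡ (suc j) = sym (latticeVector-tail α q x (+ 0) tail j)
  box : InBox (target α τ) d v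
  box = Equivalence.from (InBox-target⇔ α τ d v)
          (subst (λ z → + ∣ z ∣ ≤ + d) (sym (i≡j⇒i-j≡0 v₀≡ατ)) (+≤+ ℕ.z≤n) , ∣tail∣≤d)

lemma4p1 : (n d : ℕ) (x : Fin n → ℤ) (τ α q : ℤ) →
           + d < α →
           (+ d) * ∑ (λ i → + ∣ x i ∣) + + ∣ τ ∣ < q →
           (v : Fin (suc n) → ℤ) →
           (InLattice α q x v × InBox (target α τ) d v)
           ⇔ ((v zero ≡ α * τ) × (∑ (λ i → v (suc i) * x i) ≡ τ) × (∀ i → + ∣ v (suc i) ∣ ≤ + d))
lemma4p1 n d x τ α q d<α bound<q v =
  mk⇔ (lattice∩box⇒solution d x τ α q d<α bound<q v) (solution⇒lattice∩box d x τ α q v)
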